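{- Let $p \geq 2$ be an integer and let $t > 2p-3$ be a real number. Then the graph $pK_2$ (the disjoint union of $p$ copies of $K_2$, i.e. a perfect matching with $p$ edges) is a $(-1,1,t)$-threshold graph.
   Context: For real numbers $\theta_1 < \theta_2 < \cdots < \theta_k$, a simple graph $G$ is a $(\theta_1,\ldots,\theta_k)$-threshold graph if there exist real numbers $(r_v)_{v \in V(G)}$ (ranks) such that for every pair of distinct vertices $v,w$, we have $vw \in E(G)$ if and only if the inequality $\theta_i \leq r_v + r_w$ holds for an odd number of indices $i \in \{1,\ldots,k\}$. -}

module Defs where

open import Level using (Level; _⊔_) renaming (suc to lsuc; zero to lzero)
open import Data.Nat using (ℕ; zero; suc)
open import Data.Fin using (Fin)
open import Data.List using (List; []; _∷_)
open import Data.Product using (Σ; ∃; _×_; _,_)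
open import Data.Sum using (_⊎_)
open import Data.Empty using (⊥)
open import Relation.Nullary using (¬_)
open import Relation.Binary.PropositionalEquality using (_≡_; _≢_)
open import Relation.Binary.Definitions using (Tri)
open import Function.Bundles using (_⇔_)

-- The real numbers, axiomatised as a complete ordered field
-- (these axioms characterise ℝ up to isomorphism).
record RealField : Set₁ where
  infixl 6 _+_
  infixl 7 _*_
  infix  4 _<_ _≤_
  field
    ℝ    : Set
    0# 1# : ℝ
    _+_ _*_ : ℝ → ℝ → ℝ
    -_  : ℝ → ℝ
    _⁻¹ : ℝ → ℝ
    _<_ : ℝ → ℝ → Set
    +-assoc : ∀ a b c → (a + b) + c ≡ a + (b + c)
    +-comm  : ∀ a b → a + b ≡ b + a
    +-idˡ   : ∀ a → 0# + a ≡ a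
    +-invˡ  : ∀ a → (- a) + a ≡ 0#
    *-assoc : ∀ a b c → (a * b) * c ≡ a * (b * c)
    *-comm  : ∀ a b → a * b ≡ b * a
    *-idˡ   : ∀ a → 1# * a ≡ a
    *-invˡ  : ∀ a → a ≢ 0# → (a ⁻¹) * a ≡ 1#
    distribˡ : ∀ a b c → a * (b + c) ≡ (a * b) + (a * c)
    0≢1     : 0# ≢ 1#
    <-irrefl : ∀ a → ¬ (a < a)
    <-trans  : ∀ {a b c} → a < b → b < c → a < c
    compare  : ∀ a b → Tri (a < b) (a ≡ b) (b < a)
    +-mono-< : ∀ {a b} c → a < b → a + c < b + c
    *-pos    : ∀ {a b} → 0# < a → 0# < b → 0# < a * b

  _≤_ : ℝ → ℝ → Set
  a ≤ b = a < b ⊎ a ≡ b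

  field
    complete : (S : ℝ → Set) → (∃ λ x → S x) → (∃ λ u → ∀ x → S x → x ≤ u) →
               ∃ λ s → (∀ x → S x → x ≤ s) × (∀ u → (∀ x → S x → x ≤ u) → s ≤ u)

  _-_ : ℝ → ℝ → ℝ
  a - b = a + (- b)

  fromℕ : ℕ → ℝ
  fromℕ zero    = 0#
  fromℕ (suc n) = fromℕ n + 1#

  -- "θ ≤ x holds for an odd number of θ in the list"
  OddCount : List ℝ → ℝ → Set
  OddCount []       x = ⊥
  OddCount (θ ∷ θs) x = (θ ≤ x × ¬ OddCount θs x) ⊎ (¬ (θ ≤ x) × OddCount θs x)

  Increasing : List ℝ → Set
  Increasing []             = Data.Unit.⊤
    where import Data.Unit
  Increasing (a ∷ [])       = Data.Unit.⊤
    where import Data.Unit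
  Increasing (a ∷ b ∷ θs)   = a < b × Increasing (b ∷ θs)

  -- A simple graph on vertex set V, given by its adjacency relation E,
  -- is a (θ₁,…,θₖ)-threshold graph (θs = [θ₁,…,θₖ], θ₁ < ⋯ < θₖ).
  IsThresholdGraph : {V : Set} → (V → V → Set) → List ℝ → Set
  IsThresholdGraph {V} E θs =
    Increasing θs ×
    Σ (V → ℝ) λ r → ∀ v w → v ≢ w → (E v w ⇔ OddCount θs (r v + r w))

-- The graph pK₂: vertices (i , a) with i : Fin p (which copy of K₂) and
-- a : Fin 2 (which endpoint); (i , a) ~ (j , b) iff i ≡ j and a ≢ b.
pK₂ : (p : ℕ) → Fin p × Fin 2 → Fin p × Fin 2 → Set
pK₂ p (i , a) (j , b) = i ≡ j × a ≢ b

-- With N = 2p − 3 < t pick a scale s with 1 < s and N·s < t, and give the two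
-- endpoints of the i-th edge (i = 0, …, p − 1) the ranks ∓ i·s. Matched endpoints
-- sum to 0, which lies in [−1, 1) and so passes exactly one threshold. Any other
-- pair sums to ± m·s with 1 ≤ m ≤ N, which is either below −1 or in (1, t) and
-- so passes no threshold or exactly two.
module Submission where

open import Defs
open import Algebra.Bundles using (CommutativeRing)
open import Algebra.Structures using (IsCommutativeRing)
open import Data.Empty using (⊥-elim)
open import Data.Fin using (Fin; toℕ; zero; suc) renaming (_≟_ to _≟ᶠ_)
open import Data.Fin.Properties using (toℕ<n; toℕ-injective)
open import Data.List using (_∷_; [])
open import Data.Nat using (ℕ; zero; suc; s≤s; z≤n; _≤′_; ≤′-refl; ≤′-step)
  renaming (_≤_ to _≤ℕ_; _<_ to _<ℕ_; _+_ to _+ℕ_; _*_ to _*ℕ_; _∸_ to _∸ℕ_)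
open import Data.Nat.Properties as ℕ
  using (≤⇒≤′; <-cmp; m+n≤o⇒m≤o∸n; m∸n+n≡m; m<n⇒0<n∸m; m∸n≤m; m≤n+m)
open import Data.Nat.Tactic.RingSolver using (solve)
open import Data.Product using (Σ; _×_; _,_)
open import Data.Sum using (inj₁; inj₂)
open import Data.Unit using (tt)
open import Function.Base using (_∘_)
open import Function.Bundles using (_⇔_; mk⇔)
open import Level using (0ℓ)
open import Relation.Binary.Bundles using (StrictPartialOrder)
open import Relation.Binary.Definitions using (Tri; tri<; tri≈; tri>)
open import Relation.Binary.PropositionalEquality
open import Relation.Nullary using (¬_; yes; no; contradiction)

sum-of-increasing<n≤2n∸3 : ∀ {i j n} → i <ℕ j → j <ℕ n → i +ℕ j ≤ℕ 2 *ℕ n ∸ℕ 3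
sum-of-increasing<n≤2n∸3 {i} {j} {n} i<j j<n = m+n≤o⇒m≤o∸n (i +ℕ j) (begin
  i +ℕ j +ℕ 3          ≡⟨ solve (i ∷ j ∷ []) ⟩
  suc (suc i) +ℕ suc j ≤⟨ ℕ.+-mono-≤ (ℕ.≤-trans (s≤s i<j) j<n) j<n ⟩
  n +ℕ n               ≡⟨ solve (n ∷ []) ⟩
  2 *ℕ n               ∎)
  where open ℕ.≤-Reasoning

sum-of-distinct<n≤2n∸3 : ∀ {k l n} → k <ℕ n → l <ℕ n → k ≢ l → k +ℕ l ≤ℕ 2 *ℕ n ∸ℕ 3
sum-of-distinct<n≤2n∸3 {k} {l} {n} k<n l<n k≢l with <-cmp k l
... | tri< k<l _ _ = sum-of-increasing<n≤2n∸3 k<l l<n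
... | tri≈ _ k≡l _ = contradiction k≡l k≢l
... | tri> _ _ l<k = subst (_≤ℕ 2 *ℕ n ∸ℕ 3) (ℕ.+-comm l k) (sum-of-increasing<n≤2n∸3 l<k k<n)

distinct⇒0<sum : ∀ {k l} → k ≢ l → 0 <ℕ k +ℕ l
distinct⇒0<sum {zero}  {zero}  k≢l = contradiction refl k≢l
distinct⇒0<sum {zero}  {suc l} _   = s≤s z≤n
distinct⇒0<sum {suc k} {l}     _   = s≤s z≤n

module RealFieldProperties (R : RealField) where
  open RealField R

  isCommutativeRing : IsCommutativeRing _≡_ _+_ _*_ -_ 0# 1#
  isCommutativeRing = record
    { isRing = record
      { +-isAbelianGroup = record
        { isGroup = record
          { isMonoid = record
            { isSemigroup = record
              { isMagma = record { isEquivalence = isEquivalence ; ∙-cong = cong₂ _+_ }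
              ; assoc   = +-assoc
              }
            ; identity = +-idˡ , λ a → trans (+-comm a 0#) (+-idˡ a)
            }
          ; inverse = +-invˡ , λ a → trans (+-comm a (- a)) (+-invˡ a)
          ; ⁻¹-cong = cong (-_)
          }
        ; comm = +-comm
        }
      ; *-cong     = cong₂ _*_
      ; *-assoc    = *-assoc
      ; *-identity = *-idˡ , λ a → trans (*-comm a 1#) (*-idˡ a)
      ; distrib    = distribˡ , λ a b c →
          trans (*-comm (b + c) a) (trans (distribˡ a b c) (cong₂ _+_ (*-comm a b) (*-comm a c)))
      }
    ; *-comm = *-comm
    }

  commutativeRing : CommutativeRing _ _
  commutativeRing = record { isCommutativeRing = isCommutativeRing }

  open CommutativeRing commutativeRing
    using (+-identityʳ; -‿inverseʳ; *-identityʳ; distribʳ; zeroˡ; ring; +-abelianGroup)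
  open import Algebra.Properties.Ring ring using (-1*x≈-x; -‿distribˡ-*)
  open import Algebra.Properties.AbelianGroup +-abelianGroup
    using (ε⁻¹≈ε; ⁻¹-involutive; ⁻¹-∙-comm; ⁻¹-anti-homo‿-; \\-leftDividesˡ; //-rightDividesˡ; //-rightDividesʳ)

  strictPartialOrder : StrictPartialOrder 0ℓ 0ℓ 0ℓ
  strictPartialOrder = record
    { isStrictPartialOrder = record
      { isEquivalence = isEquivalence
      ; irrefl        = λ { {x} refl → <-irrefl x }
      ; trans         = <-trans
      ; <-resp-≈      = (λ {x} → subst (x <_)) , (λ {y} → subst (_< y))
      }
    }

  open import Relation.Binary.Reasoning.StrictPartialOrder strictPartialOrder

  <-≤-trans : ∀ {a b c} → a < b → b ≤ c → a < c
  <-≤-trans a<b (inj₁ b<c) = <-trans a<b b<c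
  <-≤-trans a<b (inj₂ refl) = a<b

  <⇒≱ : ∀ {a b} → a < b → ¬ (b ≤ a)
  <⇒≱ {a} a<b b≤a = <-irrefl a (<-≤-trans a<b b≤a)

  +-monoʳ-< : ∀ c {a b} → a < b → c + a < c + b
  +-monoʳ-< c {a} {b} a<b = subst₂ _<_ (+-comm a c) (+-comm b c) (+-mono-< c a<b)

  x<x+y : ∀ x {y} → 0# < y → x < x + y
  x<x+y x {y} 0<y = subst (_< x + y) (+-identityʳ x) (+-monoʳ-< x 0<y)

  x<y⇒0<y-x : ∀ {x y} → x < y → 0# < y - x
  x<y⇒0<y-x {x} {y} x<y = subst (_< y - x) (-‿inverseʳ x) (+-mono-< (- x) x<y)

  neg-mono-< : ∀ {a b} → a < b → - b < - a
  neg-mono-< {a} {b} a<b = subst₂ _<_ (\\-leftDividesˡ a (- b)) b+[-a-b]≡-a (+-mono-< (- a + - b) a<b)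
    where
    b+[-a-b]≡-a : b + (- a + - b) ≡ - a
    b+[-a-b]≡-a = trans (cong (b +_) (+-comm (- a) (- b))) (\\-leftDividesˡ b (- a))

  x<0⇒0<-x : ∀ {x} → x < 0# → 0# < - x
  x<0⇒0<-x x<0 = subst (_< _) ε⁻¹≈ε (neg-mono-< x<0)

  0<1 : 0# < 1#
  0<1 with compare 0# 1#
  ... | tri< 0<1 _ _ = 0<1
  ... | tri≈ _ 0≡1 _ = ⊥-elim (0≢1 0≡1)
  ... | tri> _ _ 1<0 = ⊥-elim (<-irrefl 0# (<-trans 0<1′ 1<0))
    where
    -1*-1≡1 : - 1# * - 1# ≡ 1#
    -1*-1≡1 = trans (-1*x≈-x (- 1#)) (⁻¹-involutive 1#)
    0<1′ : 0# < 1#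
    0<1′ = subst (0# <_) -1*-1≡1 (*-pos (x<0⇒0<-x 1<0) (x<0⇒0<-x 1<0))

  -1<0 : - 1# < 0#
  -1<0 = subst (- 1# <_) ε⁻¹≈ε (neg-mono-< 0<1)

  -1<1 : - 1# < 1#
  -1<1 = <-trans -1<0 0<1

  0<x⇒0<x⁻¹ : ∀ {x} → 0# < x → 0# < x ⁻¹
  0<x⇒0<x⁻¹ {x} 0<x = trichotomy (compare 0# (x ⁻¹))
    where
    x⁻¹*x≡1 : x ⁻¹ * x ≡ 1#
    x⁻¹*x≡1 = *-invˡ x (λ { refl → <-irrefl 0# 0<x })
    trichotomy : Tri (0# < x ⁻¹) (0# ≡ x ⁻¹) (x ⁻¹ < 0#) → 0# < x ⁻¹
    trichotomy (tri< 0<x⁻¹ _ _) = 0<x⁻¹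
    trichotomy (tri≈ _ 0≡x⁻¹ _) =
      ⊥-elim (0≢1 (trans (sym (zeroˡ x)) (trans (cong (_* x) 0≡x⁻¹) x⁻¹*x≡1)))
    trichotomy (tri> _ _ x⁻¹<0) = ⊥-elim (<-irrefl 0# (<-trans 0<-1 -1<0))
      where
      0<-1 : 0# < - 1#
      0<-1 = subst (0# <_) (trans (sym (-‿distribˡ-* (x ⁻¹) x)) (cong (-_) x⁻¹*x≡1))
                   (*-pos (x<0⇒0<-x x⁻¹<0) 0<x)

  ≤-<-trans : ∀ {a b c} → a ≤ b → b < c → a < c
  ≤-<-trans (inj₁ a<b) b<c = <-trans a<b b<c
  ≤-<-trans (inj₂ refl) b<c = b<c

  fromℕ-+ : ∀ m n → fromℕ (m +ℕ n) ≡ fromℕ m + fromℕ n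
  fromℕ-+ zero    n = sym (+-idˡ (fromℕ n))
  fromℕ-+ (suc m) n = begin-equality
    fromℕ (m +ℕ n) + 1#         ≡⟨ cong (_+ 1#) (fromℕ-+ m n) ⟩
    fromℕ m + fromℕ n + 1#      ≡⟨ +-assoc (fromℕ m) (fromℕ n) 1# ⟩
    fromℕ m + (fromℕ n + 1#)    ≡⟨ cong (fromℕ m +_) (+-comm (fromℕ n) 1#) ⟩
    fromℕ m + (1# + fromℕ n)    ≡⟨ +-assoc (fromℕ m) 1# (fromℕ n) ⟨
    fromℕ m + 1# + fromℕ n      ∎

  0<fromℕ-suc : ∀ n → 0# < fromℕ (suc n)
  0<fromℕ-suc zero    = subst (0# <_) (sym (+-idˡ 1#)) 0<1
  0<fromℕ-suc (suc n) = <-trans (0<fromℕ-suc n) (x<x+y (fromℕ (suc n)) 0<1)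

  additive-∸ : (f : ℕ → ℝ) → (∀ m n → f (m +ℕ n) ≡ f m + f n) →
               ∀ {m n} → n ≤ℕ m → f m - f n ≡ f (m ∸ℕ n)
  additive-∸ f f-+ {m} {n} n≤m = begin-equality
    f m - f n                  ≡⟨ cong (λ k → f k - f n) (m∸n+n≡m n≤m) ⟨
    f (m ∸ℕ n +ℕ n) - f n      ≡⟨ cong (_- f n) (f-+ (m ∸ℕ n) n) ⟩
    (f (m ∸ℕ n) + f n) - f n   ≡⟨ //-rightDividesʳ (f n) (f (m ∸ℕ n)) ⟩
    f (m ∸ℕ n)                 ∎

  scale-exists : ∀ {N t} → fromℕ N < t → Σ ℝ λ s → 1# < s × fromℕ N * s < t
  scale-exists {N} {t} N<t = 1# + e , x<x+y 1# 0<e , Ns<t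
    where
    H = fromℕ (suc N)
    d = t - fromℕ N
    e = d * H ⁻¹
    0<H : 0# < H
    0<H = 0<fromℕ-suc N
    0<e : 0# < e
    0<e = *-pos (x<y⇒0<y-x N<t) (0<x⇒0<x⁻¹ 0<H)
    H*e≡d : H * e ≡ d
    H*e≡d = begin-equality
      H * (d * H ⁻¹)   ≡⟨ *-comm H (d * H ⁻¹) ⟩
      d * H ⁻¹ * H     ≡⟨ *-assoc d (H ⁻¹) H ⟩
      d * (H ⁻¹ * H)   ≡⟨ cong (d *_) (*-invˡ H (λ H≡0 → <-irrefl 0# (subst (0# <_) H≡0 0<H))) ⟩
      d * 1#           ≡⟨ *-identityʳ d ⟩
      d                ∎
    Ns<t : fromℕ N * (1# + e) < t
    Ns<t = begin-strict
      fromℕ N * (1# + e)           ≡⟨ distribˡ (fromℕ N) 1# e ⟩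
      fromℕ N * 1# + fromℕ N * e   ≡⟨ cong (_+ fromℕ N * e) (*-identityʳ (fromℕ N)) ⟩
      fromℕ N + fromℕ N * e        <⟨ +-monoʳ-< (fromℕ N) (x<x+y (fromℕ N * e) 0<e) ⟩
      fromℕ N + (fromℕ N * e + e)  ≡⟨ cong (λ z → fromℕ N + (fromℕ N * e + z)) (*-idˡ e) ⟨
      fromℕ N + (fromℕ N * e + 1# * e) ≡⟨ cong (fromℕ N +_) (distribʳ e (fromℕ N) 1#) ⟨
      fromℕ N + H * e              ≡⟨ cong (fromℕ N +_) H*e≡d ⟩
      fromℕ N + (t - fromℕ N)      ≡⟨ +-comm (fromℕ N) d ⟩
      t - fromℕ N + fromℕ N        ≡⟨ //-rightDividesˡ (fromℕ N) t ⟩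
      t                            ∎

  module Multiples {s : ℝ} (1<s : 1# < s) where

    X : ℕ → ℝ
    X n = fromℕ n * s

    X-+ : ∀ m n → X (m +ℕ n) ≡ X m + X n
    X-+ m n = trans (cong (_* s) (fromℕ-+ m n)) (distribʳ s (fromℕ m) (fromℕ n))

    X-∸ : ∀ {m n} → n ≤ℕ m → X m - X n ≡ X (m ∸ℕ n)
    X-∸ = additive-∸ X X-+

    X<X-suc : ∀ n → X n < X (suc n)
    X<X-suc n = subst (X n <_) (sym X-suc) (x<x+y (X n) (<-trans 0<1 1<s))
      where
      X-suc : X (suc n) ≡ X n + s
      X-suc = trans (distribʳ s (fromℕ n) 1#) (cong (X n +_) (*-idˡ s))

    X-mono-≤ : ∀ {m n} → m ≤ℕ n → X m ≤ X n
    X-mono-≤ m≤n = mono′ (≤⇒≤′ m≤n)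
      where
      mono′ : ∀ {m n} → m ≤′ n → X m ≤ X n
      mono′ ≤′-refl           = inj₂ refl
      mono′ (≤′-step {n} m≤n) = inj₁ (≤-<-trans (mono′ m≤n) (X<X-suc n))

    1<X : ∀ {m} → 0 <ℕ m → 1# < X m
    1<X {suc m} _ = <-≤-trans 1<X₁ (X-mono-≤ {1} {suc m} (s≤s z≤n))
      where
      1<X₁ : 1# < X 1
      1<X₁ = subst (1# <_) (sym (trans (cong (_* s) (+-idˡ 1#)) (*-idˡ s))) 1<s

  module ThreeThresholds {a b c : ℝ} (a<b : a < b) (b<c : b < c) where

    Odd : ℝ → Set
    Odd = OddCount (a ∷ b ∷ c ∷ [])

    a≤x<b⇒odd : ∀ {x} → a ≤ x → x < b → Odd x
    a≤x<b⇒odd a≤x x<b = inj₁ (a≤x , λ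
      { (inj₁ (b≤x , _))            → <⇒≱ x<b b≤x
      ; (inj₂ (_ , inj₁ (c≤x , _))) → <⇒≱ (<-trans x<b b<c) c≤x
      ; (inj₂ (_ , inj₂ (_ , ())))
      })

    x<a⇒even : ∀ {x} → x < a → ¬ Odd x
    x<a⇒even x<a (inj₁ (a≤x , _))                     = <⇒≱ x<a a≤x
    x<a⇒even x<a (inj₂ (_ , inj₁ (b≤x , _)))          = <⇒≱ (<-trans x<a a<b) b≤x
    x<a⇒even x<a (inj₂ (_ , inj₂ (_ , inj₁ (c≤x , _)))) = <⇒≱ (<-trans x<a (<-trans a<b b<c)) c≤x
    x<a⇒even x<a (inj₂ (_ , inj₂ (_ , inj₂ (_ , ()))))

    b≤x<c⇒even : ∀ {x} → b ≤ x → x < c → ¬ Odd x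
    b≤x<c⇒even b≤x x<c (inj₁ (_ , ¬odd)) = ¬odd (inj₁ (b≤x , λ
      { (inj₁ (c≤x , _)) → <⇒≱ x<c c≤x
      ; (inj₂ (_ , ()))
      }))
    b≤x<c⇒even b≤x x<c (inj₂ (a≰x , _)) = a≰x (inj₁ (<-≤-trans a<b b≤x))

  module Matching (p : ℕ) {s t : ℝ} (1<s : 1# < s) (1<t : 1# < t)
                  (Ns<t : fromℕ (2 *ℕ p ∸ℕ 3) * s < t) where
    open Multiples 1<s
    open ThreeThresholds -1<1 1<t

    N : ℕ
    N = 2 *ℕ p ∸ℕ 3

    X-even : ∀ {m} → 0 <ℕ m → m ≤ℕ N → ¬ Odd (X m)
    X-even 0<m m≤N = b≤x<c⇒even (inj₁ (1<X 0<m)) (≤-<-trans (X-mono-≤ m≤N) Ns<t)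

    -X-even : ∀ {m} → 0 <ℕ m → ¬ Odd (- X m)
    -X-even 0<m = x<a⇒even (neg-mono-< (1<X 0<m))

    -X+X-even : ∀ {k l} → k ≢ l → k +ℕ l ≤ℕ N → ¬ Odd (- X k + X l)
    -X+X-even {k} {l} k≢l k+l≤N with <-cmp k l
    ... | tri< k<l _ _ = X-even (m<n⇒0<n∸m k<l) l∸k≤N ∘ subst Odd -X+X≡X[l∸k]
      where
      l∸k≤N : l ∸ℕ k ≤ℕ N
      l∸k≤N = ℕ.≤-trans (m∸n≤m l k) (ℕ.≤-trans (m≤n+m l k) k+l≤N)
      -X+X≡X[l∸k] : - X k + X l ≡ X (l ∸ℕ k)
      -X+X≡X[l∸k] = trans (+-comm (- X k) (X l)) (X-∸ (ℕ.<⇒≤ k<l))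
    ... | tri≈ _ k≡l _ = contradiction k≡l k≢l
    ... | tri> _ _ l<k = -X-even (m<n⇒0<n∸m l<k) ∘ subst Odd -X+X≡-X[k∸l]
      where
      -X+X≡-X[k∸l] : - X k + X l ≡ - X (k ∸ℕ l)
      -X+X≡-X[k∸l] = begin-equality
        - X k + X l       ≡⟨ +-comm (- X k) (X l) ⟩
        X l - X k         ≡⟨ ⁻¹-anti-homo‿- (X k) (X l) ⟨
        - (X k - X l)     ≡⟨ cong (-_) (X-∸ (ℕ.<⇒≤ l<k)) ⟩
        - X (k ∸ℕ l)      ∎

    rank : Fin p × Fin 2 → ℝ
    rank (i , zero)  = - X (toℕ i)
    rank (i , suc _) = X (toℕ i)

    rank-sum-matched : ∀ i {a b} → a ≢ b → rank (i , a) + rank (i , b) ≡ 0#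
    rank-sum-matched i {zero}     {zero}     a≢b = contradiction refl a≢b
    rank-sum-matched i {zero}     {suc _}    _   = +-invˡ (X (toℕ i))
    rank-sum-matched i {suc _}    {zero}     _   = -‿inverseʳ (X (toℕ i))
    rank-sum-matched i {suc zero} {suc zero} a≢b = contradiction refl a≢b

    rank-sum-unmatched-even : ∀ {i j} a b → i ≢ j → ¬ Odd (rank (i , a) + rank (j , b))
    rank-sum-unmatched-even {i} {j} a b i≢j = even a b
      where
      k = toℕ i
      l = toℕ j
      k≢l : k ≢ l
      k≢l = i≢j ∘ toℕ-injective
      k+l≤N : k +ℕ l ≤ℕ N
      k+l≤N = sum-of-distinct<n≤2n∸3 (toℕ<n i) (toℕ<n j) k≢l
      even : ∀ a b → ¬ Odd (rank (i , a) + rank (j , b))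
      even zero    zero    = -X-even (distinct⇒0<sum k≢l)
                           ∘ subst Odd (trans (⁻¹-∙-comm (X k) (X l)) (cong (-_) (sym (X-+ k l))))
      even zero    (suc _) = -X+X-even k≢l k+l≤N
      even (suc _) zero    = -X+X-even (k≢l ∘ sym) (subst (_≤ℕ N) (ℕ.+-comm k l) k+l≤N)
                           ∘ subst Odd (+-comm (X k) (- X l))
      even (suc _) (suc _) = X-even (distinct⇒0<sum k≢l) k+l≤N ∘ subst Odd (sym (X-+ k l))

    pK₂-adjacency : ∀ v w → v ≢ w → pK₂ p v w ⇔ Odd (rank v + rank w)
    pK₂-adjacency (i , a) (j , b) v≢w with i ≟ᶠ j
    ... | yes refl = mk⇔ (λ _ → subst Odd (sym (rank-sum-matched i a≢b)) (a≤x<b⇒odd (inj₁ -1<0) 0<1))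
                         (λ _ → refl , a≢b)
      where
      a≢b : a ≢ b
      a≢b = v≢w ∘ cong (i ,_)
    ... | no i≢j = mk⇔ (λ (i≡j , _) → contradiction i≡j i≢j)
                       (λ odd → contradiction odd (rank-sum-unmatched-even a b i≢j))

    pK₂-isThresholdGraph : IsThresholdGraph (pK₂ p) (- 1# ∷ 1# ∷ t ∷ [])
    pK₂-isThresholdGraph = (-1<1 , 1<t , tt) , rank , pK₂-adjacency

mainTheorem1 : (R : RealField) → let open RealField R in
    (p : ℕ) → 2 ≤ℕ p → (t : ℝ) → fromℕ (2 *ℕ p) - fromℕ 3 < t →
    IsThresholdGraph (pK₂ p) ((- 1#) ∷ 1# ∷ t ∷ [])
mainTheorem1 R p 2≤p t 2p-3<t =
  let s , 1<s , Ns<t = scale-exists {2 *ℕ p ∸ℕ 3} N<t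
      1<t = <-trans (Multiples.1<X 1<s (m<n⇒0<n∸m 3<2p)) Ns<t
  in  Matching.pK₂-isThresholdGraph p 1<s 1<t Ns<t
  where
  open RealField R
  open RealFieldProperties R
  3<2p : 3 <ℕ 2 *ℕ p
  3<2p = ℕ.*-monoʳ-≤ 2 2≤p
  N<t : fromℕ (2 *ℕ p ∸ℕ 3) < t
  N<t = subst (_< t) (additive-∸ fromℕ fromℕ-+ (ℕ.<⇒≤ 3<2p)) 2p-3<t
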